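{- Let $\varphi$ be a $2$CNF formula over the variable set $X=\{x_1,\dots,x_n\}$, let $\varphi'$ be the copy of $\varphi$ obtained by replacing each $x_i$ by a new variable $y_i$ ($Y=\{y_1,\dots,y_n\}$), and let $$\varphi^*=\varphi\land\varphi'\land\bigwedge_{1\le i\le n}\big((x_i\lor y_i)\land(\neg x_i\lor\neg y_i)\big).$$ Let $S$ be the set of the clauses $x_i\lor y_i$ and $\neg x_i\lor\neg y_i$ ($1\le i\le n$) of $\varphi^*$. Let $s$ be a nonnegative integer. Then there are two satisfying assignments $\alpha_1,\alpha_2$ of $\varphi$ with $|\alpha_1\triangle\alpha_2|\ge n-s$ if and only if there are at most $s$ clauses in $S$ whose removal from $\varphi^*$ makes it satisfiable.
   Context: A $2$CNF formula is a conjunction of clauses each with at most two literals. For truth assignments $\alpha_1,\alpha_2$ on $X$, $\alpha_1\triangle\alpha_2=\{x\in X:\alpha_1(x)\neq\alpha_2(x)\}$. -}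

module Defs where

open import Data.Nat using (ℕ; _≤_)
open import Data.Bool using (Bool; true; false; not; _xor_)
open import Data.Fin using (Fin)
open import Data.Fin.Subset using (Subset)
open import Data.Vec using (tabulate)
open import Data.List using (List; []; _∷_; _++_; map; length; allFin)
open import Data.List.Relation.Unary.All using (All)
open import Data.List.Relation.Unary.Any using (Any)
open import Data.List.Membership.Propositional using (_∈_)
open import Data.Sum using (_⊎_; inj₁; inj₂)
open import Data.Product using (Σ; _×_; ∃)
open import Relation.Binary.PropositionalEquality using (_≡_)

data Lit (V : Set) : Set where
  pos : V → Lit V
  neg : V → Lit V

Clause : Set → Set
Clause V = List (Lit V)

CNF : Set → Set
CNF V = List (Clause V)

Is2CNF : {V : Set} → CNF V → Set
Is2CNF φ = All (λ c → length c ≤ 2) φ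

Assignment : Set → Set
Assignment V = V → Bool

litVal : {V : Set} → Assignment V → Lit V → Bool
litVal α (pos v) = α v
litVal α (neg v) = not (α v)

SatClause : {V : Set} → Assignment V → Clause V → Set
SatClause α c = Any (λ l → litVal α l ≡ true) c

Satisfies : {V : Set} → Assignment V → CNF V → Set
Satisfies α φ = All (SatClause α) φ

renameLit : {V W : Set} → (V → W) → Lit V → Lit W
renameLit f (pos v) = pos (f v)
renameLit f (neg v) = neg (f v)

renameCNF : {V W : Set} → (V → W) → CNF V → CNF W
renameCNF f φ = map (map (renameLit f)) φ

symDiff : {n : ℕ} → Assignment (Fin n) → Assignment (Fin n) → Subset n
symDiff α₁ α₂ = tabulate (λ i → α₁ i xor α₂ i)

-- Variables of φ* : x_i = inj₁ i, y_i = inj₂ i.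
-- The set S of clauses  x_i ∨ y_i  and  ¬x_i ∨ ¬y_i.
Sclauses : (n : ℕ) → CNF (Fin n ⊎ Fin n)
Sclauses n = map (λ i → pos (inj₁ i) ∷ pos (inj₂ i) ∷ []) (allFin n)
          ++ map (λ i → neg (inj₁ i) ∷ neg (inj₂ i) ∷ []) (allFin n)

phiStar : {n : ℕ} → CNF (Fin n) → CNF (Fin n ⊎ Fin n)
phiStar {n} φ = renameCNF inj₁ φ ++ renameCNF inj₂ φ ++ Sclauses n

SatAfterRemoving : {V : Set} → CNF V → List (Clause V) → Set
SatAfterRemoving {V} ψ T =
  ∃ λ (α : Assignment V) → All (λ c → c ∈ T ⊎ SatClause α c) ψ

{-# OPTIONS --safe #-}
-- An assignment β of φ* is a pair α₁ = β ∘ inj₁, α₂ = β ∘ inj₂, and β satisfies the two copies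
-- of φ iff α₁ and α₂ satisfy φ. Of the two S-clauses x_i ∨ y_i and ¬x_i ∨ ¬y_i, β falsifies
-- one exactly when α₁ i = α₂ i, and then only the one for the common value. So β falsifies
-- n − |α₁ △ α₂| distinct S-clauses: removing exactly these makes φ* satisfiable, and every
-- removable T ⊆ S that leaves β a model must contain them (a copy clause of φ is never in S).
module Submission where

open import Defs
open import Data.Nat as ℕ using (ℕ; _≤_; _≥_; _+_; _∸_)
open import Data.Nat.Properties using (m≤n+o⇒m∸n≤o; m≤n+m∸n; +-monoʳ-≤; +-comm; ≤-trans; module ≤-Reasoning)
open import Data.Bool using (Bool; true; false; not; _xor_)
open import Data.Bool.Properties using (¬-not; xor-same) renaming (_≟_ to _≟ᵇ_)
open import Data.Fin using (Fin; zero; suc)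
open import Data.Fin.Properties using (injective⇒≤)
open import Data.Fin.Subset as Subset using (Subset; inside; outside; ∁; ∣_∣)
open import Data.Fin.Subset.Properties using (_∈?_; ∣∁p∣≡n∸∣p∣)
open import Data.Vec using ([]; _∷_; lookup)
open import Data.Vec.Properties using (lookup-map; lookup∘tabulate; []=⇒lookup; lookup⇒[]=)
open import Data.List as List using (List; []; _∷_; length; map; filter; allFin; tabulate)
open import Data.List.Properties using (length-map; map-tabulate)
open import Data.List.Relation.Unary.All as All using (All)
import Data.List.Relation.Unary.All.Properties as Allₚ
open import Data.List.Relation.Unary.AllPairs using (_∷_)
open import Data.List.Relation.Unary.Any as Any using (here; there; index)
import Data.List.Relation.Unary.Any.Properties as Anyₚ
open import Data.List.Relation.Unary.Unique.Propositional using (Unique)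
import Data.List.Relation.Unary.Unique.Propositional.Properties as Uniqueₚ
open import Data.List.Membership.Propositional using (_∈_; _∉_)
open import Data.List.Membership.Propositional.Properties
  using (∈-lookup; ∈-filter⁺; ∈-filter⁻; ∈-allFin; ∈-map⁺; ∈-map⁻; ∈-++⁺ˡ; ∈-++⁺ʳ; ∈-++⁻)
open import Data.List.Relation.Binary.Subset.Propositional using (_⊆_)
open import Data.Product using (_×_; _,_; proj₂; ∃; ∃₂)
open import Data.Sum using (_⊎_; inj₁; inj₂; [_,_]; fromInj₁)
open import Data.Empty using (⊥-elim)
open import Function using (_∘_; id)
open import Function.Bundles using (_⇔_; mk⇔)
open import Function.Definitions using (Injective)
open import Relation.Nullary using (¬_; does; yes; no; contradiction)
open import Relation.Binary.PropositionalEquality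
  using (_≡_; _≢_; refl; sym; trans; cong; subst; module ≡-Reasoning)

module _ {A : Set} where

  lookup-injective : {xs : List A} → Unique xs → Injective _≡_ _≡_ (List.lookup xs)
  lookup-injective {_ ∷ _} _          {zero}  {zero}  _  = refl
  lookup-injective {_ ∷ _} (x∉ ∷ _)   {zero}  {suc j} eq = contradiction eq (All.lookup x∉ (∈-lookup j))
  lookup-injective {_ ∷ _} (x∉ ∷ _)   {suc i} {zero}  eq = contradiction (sym eq) (All.lookup x∉ (∈-lookup i))
  lookup-injective {_ ∷ _} (_ ∷ uniq) {suc i} {suc j} eq = cong suc (lookup-injective uniq eq)

  unique∧⊆⇒length≤ : {xs ys : List A} → Unique xs → xs ⊆ ys → length xs ≤ length ys
  unique∧⊆⇒length≤ {xs} {ys} uniq xs⊆ys = injective⇒≤ position-injective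
    where
    position : Fin (length xs) → Fin (length ys)
    position k = index (xs⊆ys (∈-lookup k))

    lookup-position : ∀ k → List.lookup ys (position k) ≡ List.lookup xs k
    lookup-position k = sym (Anyₚ.lookup-index (xs⊆ys (∈-lookup k)))

    position-injective : Injective _≡_ _≡_ position
    position-injective {k} {k′} eq = lookup-injective uniq (begin
      List.lookup xs k              ≡⟨ lookup-position k ⟨
      List.lookup ys (position k)   ≡⟨ cong (List.lookup ys) eq ⟩
      List.lookup ys (position k′)  ≡⟨ lookup-position k′ ⟩
      List.lookup xs k′             ∎)
      where open ≡-Reasoning

elements : {n : ℕ} → Subset n → List (Fin n)
elements {n} p = filter (_∈? p) (allFin n)

module _ {n : ℕ} {p : Subset n} {i : Fin n} where

  ∈-elements⁺ : i Subset.∈ p → i ∈ elements p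
  ∈-elements⁺ = ∈-filter⁺ (_∈? p) (∈-allFin i)

  ∈-elements⁻ : i ∈ elements p → i Subset.∈ p
  ∈-elements⁻ = proj₂ ∘ ∈-filter⁻ (_∈? p) {xs = allFin n}

elements-unique : {n : ℕ} (p : Subset n) → Unique (elements p)
elements-unique {n} p = Uniqueₚ.filter⁺ (_∈? p) (Uniqueₚ.allFin⁺ n)

filter-∈?-map-suc : {n : ℕ} (x : Bool) (p : Subset n) (is : List (Fin n)) →
                    filter (_∈? x ∷ p) (map suc is) ≡ map suc (filter (_∈? p) is)
filter-∈?-map-suc x p [] = refl
filter-∈?-map-suc x p (i ∷ is) with does (i ∈? p)
... | true  = cong (suc i ∷_) (filter-∈?-map-suc x p is)
... | false = filter-∈?-map-suc x p is

-- elements (x ∷ p) unfolds to the filter of zero ∷ tabulate suc.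
length-filter-∈?-∷ : {n : ℕ} (x : Bool) (p : Subset n) →
                     length (filter (_∈? x ∷ p) (tabulate suc)) ≡ length (elements p)
length-filter-∈?-∷ {n} x p = begin
  length (filter (_∈? x ∷ p) (tabulate suc))        ≡⟨ cong (length ∘ filter (_∈? x ∷ p)) (map-tabulate id suc) ⟨
  length (filter (_∈? x ∷ p) (map suc (allFin n)))  ≡⟨ cong length (filter-∈?-map-suc x p (allFin n)) ⟩
  length (map suc (elements p))                     ≡⟨ length-map suc (elements p) ⟩
  length (elements p)                               ∎
  where open ≡-Reasoning

length-elements : {n : ℕ} (p : Subset n) → length (elements p) ≡ ∣ p ∣
length-elements []            = refl
length-elements (inside  ∷ p) = cong ℕ.suc (trans (length-filter-∈?-∷ inside p) (length-elements p))
length-elements (outside ∷ p) = trans (length-filter-∈?-∷ outside p) (length-elements p)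

m∸n≤o⇒m∸o≤n : ∀ m n o → m ∸ n ≤ o → m ∸ o ≤ n
m∸n≤o⇒m∸o≤n m n o m∸n≤o = m≤n+o⇒m∸n≤o m o (begin
  m            ≤⟨ m≤n+m∸n m n ⟩
  n + (m ∸ n)  ≤⟨ +-monoʳ-≤ n m∸n≤o ⟩
  n + o        ≡⟨ +-comm n o ⟩
  o + n        ∎)
  where open ≤-Reasoning

not-xor≡true⇒≡ : ∀ a b → not (a xor b) ≡ true → a ≡ b
not-xor≡true⇒≡ true  true  _ = refl
not-xor≡true⇒≡ false false _ = refl

SatisfiesExcept : {V : Set} → Assignment V → List (Clause V) → CNF V → Set
SatisfiesExcept α T ψ = All (λ c → c ∈ T ⊎ SatClause α c) ψ

module _ {V W : Set} {β : Assignment W} {f : V → W} where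

  litVal-renameLit : (l : Lit V) → litVal β (renameLit f l) ≡ litVal (β ∘ f) l
  litVal-renameLit (pos v) = refl
  litVal-renameLit (neg v) = refl

  satClause-rename⁺ : {c : Clause V} → SatClause (β ∘ f) c → SatClause β (map (renameLit f) c)
  satClause-rename⁺ = Anyₚ.map⁺ ∘ Any.map (λ {l} → trans (litVal-renameLit l))

  satClause-rename⁻ : {c : Clause V} → SatClause β (map (renameLit f) c) → SatClause (β ∘ f) c
  satClause-rename⁻ = Any.map (λ {l} → trans (sym (litVal-renameLit l))) ∘ Anyₚ.map⁻

  satisfies-rename⁺ : {φ : CNF V} → Satisfies (β ∘ f) φ → Satisfies β (renameCNF f φ)
  satisfies-rename⁺ = Allₚ.map⁺ ∘ All.map satClause-rename⁺

  satisfies-rename⁻ : {T : List (Clause W)} {φ : CNF V} →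
                      (∀ c → map (renameLit f) c ∉ T) →
                      SatisfiesExcept β T (renameCNF f φ) → Satisfies (β ∘ f) φ
  satisfies-rename⁻ copy∉T =
    All.map (λ {c} → [ (λ c∈T → contradiction c∈T (copy∉T c)) , satClause-rename⁻ ]) ∘ Allₚ.map⁻

lit : {V : Set} → Bool → V → Lit V
lit false v = pos v
lit true  v = neg v

litVal-lit-≡ : {V : Set} {α : Assignment V} {b : Bool} {v : V} → α v ≡ b → litVal α (lit b v) ≡ false
litVal-lit-≡ {b = false} e = e
litVal-lit-≡ {b = true}  e = cong not e

litVal-lit-≢ : {V : Set} {α : Assignment V} {b : Bool} {v : V} → α v ≢ b → litVal α (lit b v) ≡ true
litVal-lit-≢ {b = false} ne = ¬-not ne
litVal-lit-≢ {b = true}  ne = cong not (¬-not ne)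

module _ {n : ℕ} where

  -- The S-clause falsified when x_i = y_i = b: x_i ∨ y_i for b = false, ¬x_i ∨ ¬y_i for b = true.
  pairClause : Bool → Fin n → Clause (Fin n ⊎ Fin n)
  pairClause b i = lit b (inj₁ i) ∷ lit b (inj₂ i) ∷ []

  pairClause-injective : ∀ {b b′ i j} → pairClause b i ≡ pairClause b′ j → i ≡ j
  pairClause-injective {false} {false} refl = refl
  pairClause-injective {true}  {true}  refl = refl

  module _ {β : Assignment (Fin n ⊎ Fin n)} {b : Bool} {i : Fin n} where

    pairClause-sat : β (inj₁ i) ≢ b ⊎ β (inj₂ i) ≢ b → SatClause β (pairClause b i)
    pairClause-sat (inj₁ ne) = here (litVal-lit-≢ ne)
    pairClause-sat (inj₂ ne) = there (here (litVal-lit-≢ ne))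

    pairClause-unsat : β (inj₁ i) ≡ b → β (inj₂ i) ≡ b → ¬ SatClause β (pairClause b i)
    pairClause-unsat e₁ _ (here sat)         = contradiction (trans (sym (litVal-lit-≡ e₁)) sat) λ ()
    pairClause-unsat _ e₂ (there (here sat)) = contradiction (trans (sym (litVal-lit-≡ e₂)) sat) λ ()

  ∈-Sclauses⁺ : ∀ b i → pairClause b i ∈ Sclauses n
  ∈-Sclauses⁺ false i = ∈-++⁺ˡ (∈-map⁺ (pairClause false) (∈-allFin i))
  ∈-Sclauses⁺ true  i = ∈-++⁺ʳ _ (∈-map⁺ (pairClause true) (∈-allFin i))

  ∈-Sclauses⁻ : ∀ {c} → c ∈ Sclauses n → ∃₂ λ b i → c ≡ pairClause b i
  ∈-Sclauses⁻ c∈S with ∈-++⁻ (map (pairClause false) (allFin n)) c∈S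
  ... | inj₁ c∈S⁺ = let i , _ , eq = ∈-map⁻ (pairClause false) c∈S⁺ in false , i , eq
  ... | inj₂ c∈S⁻ = let i , _ , eq = ∈-map⁻ (pairClause true) c∈S⁻ in true , i , eq

  left-copy≢pairClause : ∀ (c : Clause (Fin n)) b i → map (renameLit inj₁) c ≢ pairClause b i
  left-copy≢pairClause []              _     _ ()
  left-copy≢pairClause (_ ∷ [])        _     _ ()
  left-copy≢pairClause (_ ∷ pos _ ∷ _) false _ ()
  left-copy≢pairClause (_ ∷ pos _ ∷ _) true  _ ()
  left-copy≢pairClause (_ ∷ neg _ ∷ _) false _ ()
  left-copy≢pairClause (_ ∷ neg _ ∷ _) true  _ ()

  right-copy≢pairClause : ∀ (c : Clause (Fin n)) b i → map (renameLit inj₂) c ≢ pairClause b i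
  right-copy≢pairClause []          _     _ ()
  right-copy≢pairClause (pos _ ∷ _) false _ ()
  right-copy≢pairClause (pos _ ∷ _) true  _ ()
  right-copy≢pairClause (neg _ ∷ _) false _ ()
  right-copy≢pairClause (neg _ ∷ _) true  _ ()

  copy∉removed : {T : List (Clause (Fin n ⊎ Fin n))} → All (_∈ Sclauses n) T →
                 {f : Fin n → Fin n ⊎ Fin n} → (∀ c b i → map (renameLit f) c ≢ pairClause b i) →
                 ∀ c → map (renameLit f) c ∉ T
  copy∉removed T⊆S copy≢ c c∈T = let b , i , eq = ∈-Sclauses⁻ (All.lookup T⊆S c∈T) in copy≢ c b i eq

module _ {n : ℕ} (α₁ α₂ : Assignment (Fin n)) where

  agreements : Subset n
  agreements = ∁ (symDiff α₁ α₂)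

  lookup-agreements : ∀ i → lookup agreements i ≡ not (α₁ i xor α₂ i)
  lookup-agreements i =
    trans (lookup-map i not (symDiff α₁ α₂)) (cong not (lookup∘tabulate (λ j → α₁ j xor α₂ j) i))

  ∈-agreements⁺ : ∀ {i} → α₁ i ≡ α₂ i → i Subset.∈ agreements
  ∈-agreements⁺ {i} e = lookup⇒[]= i agreements (begin
    lookup agreements i  ≡⟨ lookup-agreements i ⟩
    not (α₁ i xor α₂ i)  ≡⟨ cong (λ b → not (α₁ i xor b)) e ⟨
    not (α₁ i xor α₁ i)  ≡⟨ cong not (xor-same (α₁ i)) ⟩
    true                 ∎)
    where open ≡-Reasoning

  ∈-agreements⁻ : ∀ {i} → i Subset.∈ agreements → α₁ i ≡ α₂ i
  ∈-agreements⁻ {i} i∈A = not-xor≡true⇒≡ _ _ (trans (sym (lookup-agreements i)) ([]=⇒lookup i∈A))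

  violated : List (Clause (Fin n ⊎ Fin n))
  violated = map (λ i → pairClause (α₁ i) i) (elements agreements)

  length-violated : length violated ≡ n ∸ ∣ symDiff α₁ α₂ ∣
  length-violated = begin
    length violated               ≡⟨ length-map _ (elements agreements) ⟩
    length (elements agreements)  ≡⟨ length-elements agreements ⟩
    ∣ agreements ∣                ≡⟨ ∣∁p∣≡n∸∣p∣ (symDiff α₁ α₂) ⟩
    n ∸ ∣ symDiff α₁ α₂ ∣         ∎
    where open ≡-Reasoning

  violated-unique : Unique violated
  violated-unique = Uniqueₚ.map⁺ pairClause-injective (elements-unique agreements)

  violated⊆Sclauses : All (_∈ Sclauses n) violated
  violated⊆Sclauses = Allₚ.map⁺ (All.universal (λ i → ∈-Sclauses⁺ (α₁ i) i) (elements agreements))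

  Sclause-violated-or-sat : ∀ {c} → c ∈ Sclauses n → c ∈ violated ⊎ SatClause [ α₁ , α₂ ] c
  Sclause-violated-or-sat c∈S with ∈-Sclauses⁻ c∈S
  ... | b , i , refl with α₁ i ≟ᵇ b | α₂ i ≟ᵇ b
  ...   | no  α₁i≢b | _         = inj₂ (pairClause-sat (inj₁ α₁i≢b))
  ...   | yes _     | no α₂i≢b  = inj₂ (pairClause-sat (inj₂ α₂i≢b))
  ...   | yes refl  | yes α₂i≡b = inj₁ (∈-map⁺ _ (∈-elements⁺ (∈-agreements⁺ (sym α₂i≡b))))

  satisfiesExcept-violated : {φ : CNF (Fin n)} → Satisfies α₁ φ → Satisfies α₂ φ →
                             SatisfiesExcept [ α₁ , α₂ ] violated (phiStar φ)
  satisfiesExcept-violated sat₁ sat₂ =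
    Allₚ.++⁺ (All.map inj₂ (satisfies-rename⁺ sat₁))
      (Allₚ.++⁺ (All.map inj₂ (satisfies-rename⁺ sat₂))
        (All.tabulate Sclause-violated-or-sat))

module _ {n : ℕ} {β : Assignment (Fin n ⊎ Fin n)} {T : List (Clause (Fin n ⊎ Fin n))}
         (satS : SatisfiesExcept β T (Sclauses n)) where

  violated⊆removed : violated (β ∘ inj₁) (β ∘ inj₂) ⊆ T
  violated⊆removed c∈V with ∈-map⁻ _ c∈V
  ... | i , i∈A , refl =
    fromInj₁ (⊥-elim ∘ pairClause-unsat refl (sym (∈-agreements⁻ (β ∘ inj₁) (β ∘ inj₂) (∈-elements⁻ i∈A))))
             (All.lookup satS (∈-Sclauses⁺ (β (inj₁ i)) i))

  length-violated≤ : n ∸ ∣ symDiff (β ∘ inj₁) (β ∘ inj₂) ∣ ≤ length T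
  length-violated≤ = begin
    n ∸ ∣ symDiff (β ∘ inj₁) (β ∘ inj₂) ∣    ≡⟨ length-violated (β ∘ inj₁) (β ∘ inj₂) ⟨
    length (violated (β ∘ inj₁) (β ∘ inj₂))  ≤⟨ unique∧⊆⇒length≤ (violated-unique _ _) violated⊆removed ⟩
    length T                                 ∎
    where open ≤-Reasoning

lemma2 : (n : ℕ) (φ : CNF (Fin n)) → Is2CNF φ → (s : ℕ) →
    (∃ λ (α₁ : Assignment (Fin n)) → ∃ λ (α₂ : Assignment (Fin n)) →
        Satisfies α₁ φ × Satisfies α₂ φ × ∣ symDiff α₁ α₂ ∣ ≥ n ∸ s)
    ⇔
    (∃ λ (T : List (Clause (Fin n ⊎ Fin n))) →
        All (λ c → c ∈ Sclauses n) T × length T ≤ s × SatAfterRemoving (phiStar φ) T)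
lemma2 n φ _ s = mk⇔
  (λ (α₁ , α₂ , sat₁ , sat₂ , far) →
     violated α₁ α₂ , violated⊆Sclauses α₁ α₂ ,
     subst (_≤ s) (sym (length-violated α₁ α₂)) (m∸n≤o⇒m∸o≤n n s _ far) ,
     [ α₁ , α₂ ] , satisfiesExcept-violated α₁ α₂ sat₁ sat₂)
  (λ (T , T⊆S , T≤s , β , sat) →
     let sat₁ , rest = Allₚ.++⁻ (renameCNF inj₁ φ) sat
         sat₂ , satS = Allₚ.++⁻ (renameCNF inj₂ φ) rest
     in β ∘ inj₁ , β ∘ inj₂ ,
        satisfies-rename⁻ (copy∉removed T⊆S left-copy≢pairClause) sat₁ ,
        satisfies-rename⁻ (copy∉removed T⊆S right-copy≢pairClause) sat₂ ,
        m∸n≤o⇒m∸o≤n n _ s (≤-trans (length-violated≤ satS) T≤s))
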